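{- Let $k\geq 3$ and let $0<\epsilon<16^{ -k}$. Then there exists $n_0$ such that for every $k$-uniform hypergraph $G$ on $n>n_0$ vertices with $e(G)>(1-\epsilon)\binom{n}{k}$ we have $\mathrm{mc}_k(G)\geq (1-8\sqrt[k]{\epsilon})n$.
   Context: A hypergraph is connected if its shadow graph (two vertices adjacent iff they lie in a common edge) is connected; a component is a maximal connected subhypergraph, and its order is its number of vertices. For an $r$-coloring $\chi$ of the edges of $H$, $\mathrm{mc}(H,\chi)$ is the largest order of a component of the subhypergraph formed by the edges of a single color, and $\mathrm{mc}_r(H)=\min_\chi \mathrm{mc}(H,\chi)$ over all $r$-colorings $\chi$ of the edges. $e(G)$ is the number of edges. -}

module Defs where

open import Level using (0ℓ)
open import Data.Nat as ℕ using (ℕ)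
open import Data.Integer using (+_)
open import Data.Rational as ℚ using (ℚ; 0ℚ; 1ℚ; _/_)
open import Data.Fin using (Fin)
open import Data.Fin.Subset using (Subset; _∈_; ∣_∣; Nonempty)
open import Data.List using (List; length; lookup)
open import Data.List.Relation.Unary.All using (All)
open import Data.List.Relation.Unary.Unique.Propositional using (Unique)
open import Data.Product using (Σ; ∃; ∃-syntax; _×_)
open import Data.Sum using (_⊎_)
open import Data.Empty using (⊥)
open import Relation.Binary.PropositionalEquality using (_≡_)
open import Relation.Binary.Construct.Closure.ReflexiveTransitive using (Star)

ℕ→ℚ : ℕ → ℚ
ℕ→ℚ n = + n / 1

_^ℚ_ : ℚ → ℕ → ℚ
q ^ℚ ℕ.zero  = 1ℚ
q ^ℚ ℕ.suc m = q ℚ.* (q ^ℚ m)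

-- Real numbers as (two-sided) Dedekind cuts of ℚ.
-- L q  means  q < x ;  U q  means  x < q.

record ℝ : Set₁ where
  field
    L U        : ℚ → Set
    L-inhabited : ∃[ q ] L q
    U-inhabited : ∃[ q ] U q
    L-lower    : ∀ {p q} → p ℚ.< q → L q → L p
    L-rounded  : ∀ {q} → L q → ∃[ r ] (q ℚ.< r × L r)
    U-upper    : ∀ {p q} → p ℚ.< q → U p → U q
    U-rounded  : ∀ {q} → U q → ∃[ r ] (r ℚ.< q × U r)
    disjoint   : ∀ q → L q → U q → ⊥
    located    : ∀ {p q} → p ℚ.< q → L p ⊎ U q

open ℝ public

record Hypergraph (k n : ℕ) : Set where
  field
    edges   : List (Subset n)
    unique  : Unique edges
    uniform : All (λ e → ∣ e ∣ ≡ k) edges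

open Hypergraph public

e : ∀ {k n} → Hypergraph k n → ℕ
e G = length (edges G)

Colouring : ∀ {k n} → Hypergraph k n → ℕ → Set
Colouring G r = Fin (e G) → Fin r

Adj : ∀ {k n r} (G : Hypergraph k n) → Colouring G r → Fin r → Fin n → Fin n → Set
Adj G χ c u v = ∃[ i ] (χ i ≡ c × u ∈ lookup (edges G) i × v ∈ lookup (edges G) i)

-- S is a component (maximal connected set in the shadow graph) of the
-- subhypergraph formed by the edges of colour c; its order is ∣ S ∣.
IsComponent : ∀ {k n r} (G : Hypergraph k n) → Colouring G r → Fin r → Subset n → Set
IsComponent G χ c S =
  Nonempty S
  × (∀ u v → u ∈ S → v ∈ S → Star (Adj G χ c) u v)
  × (∀ u v → u ∈ S → Adj G χ c u v → v ∈ S)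

-- Let S be a largest monochromatic component and d = n − ∣S∣, so that in every colour each
-- vertex has at least d vertices outside its component. Call a k-set split if every colour
-- separates two of its vertices. An edge is never split, so fewer than ε·C(n,k) k-sets are
-- split. On the other hand, double counting triples shows that at least d²/3 ordered pairs are
-- separated by both colours 0 and 1, and appending to such a pair (a, b) one vertex outside
-- the component of a in each further colour yields at least (d − k)^(k−2) ordered split
-- k-tuples. Hence d²(d − k)^(k−2) ≤ 3·k!·#split < 3ε·n^k, which fails as soon as n is large
-- and d > 8yn for some y with ε < y^k: the left side is then at least 64(yn)^k.

module Submission where

module Counting where

  open import Level using (Level; 0ℓ)
  open import Relation.Binary using (Rel; IsDecEquivalence)
  open import Data.Nat.Tactic.RingSolver using (solve-∀)
  open import Data.Nat
  open import Data.Nat.Properties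
  open import Data.Bool using (Bool; true; false) renaming (_≟_ to _≟ᵇ_)
  open import Data.Fin using (Fin; zero; suc)
  open import Data.Fin.Properties using (any?; all?) renaming (_≟_ to _≟ᶠ_; suc-injective to suc-injectiveᶠ)
  open import Data.Vec using (Vec; []; _∷_; tabulate; lookup; here; there)
  open import Data.List using (List; []; _∷_; length; allFin) renaming (lookup to lookupₗ)
  open import Data.List.Relation.Unary.Unique.Propositional using (Unique; []; _∷_)
  import Data.List.Relation.Unary.All as ListAll
  import Data.Vec.Relation.Unary.All as VecAll
  open import Data.Unit using (⊤; tt)
  open import Function using (id; _∘_)
  open import Data.Vec.Properties using (lookup∘tabulate; []=⇒lookup; lookup⇒[]=; ≡-dec)
  open import Data.Product using (_×_; _,_; proj₁; proj₂; ∃-syntax)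
  open import Data.Sum using (_⊎_; inj₁; inj₂)
  open import Relation.Binary.Construct.Closure.ReflexiveTransitive using (Star; ε; _◅_; _◅◅_; reverse)
  open import Relation.Nullary
  open import Relation.Nullary.Decidable using (¬?; _×-dec_; _⊎-dec_; dec-true)
  open import Relation.Binary.PropositionalEquality
  open import Algebra.Properties.Semiring.Sum +-*-semiring
    using (sum; sum-syntax; sum-cong-≗; ∑-distrib-+; *-distribˡ-sum; *-distribʳ-sum)
  open import Algebra.Properties.CommutativeSemigroup +-commutativeSemigroup using (interchange)
  open import Data.Fin.Subset using (Subset; ∣_∣; _∈_; _∉_; _⊆_; _∪_; _-_; ∁; ⁅_⁆; inside; outside) renaming (⊥ to ∅)
  open import Data.Fin.Subset.Properties
    using (_∈?_; drop-there; x∈p∪q⁺; x∈p∪q⁻; ∉⊥; ∣⊥∣≡0; ∪-identityˡ; x∈p∧x≢y⇒x∈p-y; x∈p⇒∣p-x∣<∣p∣; x∉p⇒x∈∁p; x∈∁p⇒x∉p; ∣∁p∣≡n∸∣p∣; p⊂q⇒∣p∣<∣q∣; ∣p∣≤n; x∈⁅x⁆; x∈⁅y⁆⇒x≡y; ∣⁅x⁆∣≡1)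
  open import Data.Nat.Combinatorics using (_C_; _P_; nCk+nC[k+1]≡[n+1]C[k+1]; nCk≡nPk/k!; k>n⇒nCk≡0)
  open import Data.Nat.Combinatorics.Base using (_P′_)
  open import Data.Nat.DivMod using (_/_; m/n*n≤m)
  open import Data.List.Extrema.Nat as Extrema using (f[xs]≤f[argmax])
  open import Data.List.Membership.Propositional.Properties using (∈-allFin; ∈-lookup)
  open import Defs using (Hypergraph; edges; unique; uniform; e; Colouring; Adj; IsComponent)

  private variable
    ℓ ℓ′ ℓ″ : Level
    A : Set ℓ
    B : Set ℓ′
    D : Set ℓ″

  -- Indicators and finite sums

  𝟙 : Dec A → ℕ
  𝟙 (yes _) = 1
  𝟙 (no _)  = 0

  𝟙-yes : A → (a? : Dec A) → 𝟙 a? ≡ 1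
  𝟙-yes a (yes _) = refl
  𝟙-yes a (no ¬a) = contradiction a ¬a

  𝟙-no : ¬ A → (a? : Dec A) → 𝟙 a? ≡ 0
  𝟙-no ¬a (yes a) = contradiction a ¬a
  𝟙-no ¬a (no _)  = refl

  𝟙≤1 : (a? : Dec A) → 𝟙 a? ≤ 1
  𝟙≤1 (yes _) = ≤-refl
  𝟙≤1 (no _)  = z≤n

  𝟙-mono : (A → B) → (a? : Dec A) (b? : Dec B) → 𝟙 a? ≤ 𝟙 b?
  𝟙-mono f (yes a) b? = ≤-reflexive (sym (𝟙-yes (f a) b?))
  𝟙-mono f (no _)  b? = z≤n

  𝟙-cong : (A → B) → (B → A) → (a? : Dec A) (b? : Dec B) → 𝟙 a? ≡ 𝟙 b?
  𝟙-cong f g a? b? = ≤-antisym (𝟙-mono f a? b?) (𝟙-mono g b? a?)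

  𝟙-× : (a? : Dec A) (b? : Dec B) (ab? : Dec (A × B)) → 𝟙 ab? ≡ 𝟙 a? * 𝟙 b?
  𝟙-× (yes a) (yes b) ab? = 𝟙-yes (a , b) ab?
  𝟙-× (yes a) (no ¬b) ab? = 𝟙-no (¬b ∘ proj₂) ab?
  𝟙-× (no ¬a) b?      ab? = 𝟙-no (¬a ∘ proj₁) ab?

  𝟙-*-≤ : (A → B → D) → (a? : Dec A) (b? : Dec B) (d? : Dec D) → 𝟙 a? * 𝟙 b? ≤ 𝟙 d?
  𝟙-*-≤ f (yes a) (yes b) d? = ≤-reflexive (sym (𝟙-yes (f a b) d?))
  𝟙-*-≤ f (yes a) (no _)  d? = z≤n
  𝟙-*-≤ f (no _)  b?      d? = z≤n

  𝟙-⊎ : (D → A ⊎ B) → (d? : Dec D) (a? : Dec A) (b? : Dec B) → 𝟙 d? ≤ 𝟙 a? + 𝟙 b?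
  𝟙-⊎ f (no _)  a? b? = z≤n
  𝟙-⊎ f (yes d) a? b? with f d
  ... | inj₁ a = ≤-trans (≤-reflexive (sym (𝟙-yes a a?))) (m≤m+n (𝟙 a?) (𝟙 b?))
  ... | inj₂ b = ≤-trans (≤-reflexive (sym (𝟙-yes b b?))) (m≤n+m (𝟙 b?) (𝟙 a?))

  record Summation (A : Set) : Set where
    field
      ∑      : (A → ℕ) → ℕ
      ∑-cong : ∀ {f g} → f ≗ g → ∑ f ≡ ∑ g
      ∑-mono : ∀ {f g} → (∀ a → f a ≤ g a) → ∑ f ≤ ∑ g
      ∑-+    : ∀ f g → ∑ (λ a → f a + g a) ≡ ∑ f + ∑ g
      ∑-*ˡ   : ∀ c f → ∑ (λ a → c * f a) ≡ c * ∑ f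

  open Summation public

  Interchanges : ∀ {A} → Summation A → Set₁
  Interchanges {A} S = ∀ {B} (T : Summation B) (f : A → B → ℕ) →
    ∑ S (λ a → ∑ T (f a)) ≡ ∑ T (λ b → ∑ S (λ a → f a b))

  atPoint : ∀ {A} → A → Summation A
  atPoint a = record
    { ∑ = λ f → f a ; ∑-cong = λ f≗g → f≗g a ; ∑-mono = λ f≤g → f≤g a
    ; ∑-+ = λ _ _ → refl ; ∑-*ˡ = λ _ _ → refl }

  atPoint-interchanges : ∀ {A} (a : A) → Interchanges (atPoint a)
  atPoint-interchanges a T f = refl

  sum-mono-≤ : ∀ {n} {f g : Fin n → ℕ} → (∀ i → f i ≤ g i) → sum f ≤ sum g
  sum-mono-≤ {zero}  f≤g = z≤n
  sum-mono-≤ {suc n} f≤g = +-mono-≤ (f≤g zero) (sum-mono-≤ (λ i → f≤g (suc i)))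

  overFin : ∀ n → Summation (Fin n)
  overFin n = record
    { ∑ = sum ; ∑-cong = sum-cong-≗ ; ∑-mono = sum-mono-≤
    ; ∑-+ = ∑-distrib-+ ; ∑-*ˡ = λ c f → sym (*-distribˡ-sum c f) }

  overFin-interchanges : ∀ n → Interchanges (overFin n)
  overFin-interchanges zero    T f = sym (∑-*ˡ T 0 (λ _ → 0))
  overFin-interchanges (suc n) T f = begin
    ∑ T (f zero) + ∑[ i < n ] ∑ T (f (suc i))        ≡⟨ cong (∑ T (f zero) +_) (overFin-interchanges n T (λ i → f (suc i))) ⟩
    ∑ T (f zero) + ∑ T (λ b → ∑[ i < n ] f (suc i) b) ≡⟨ sym (∑-+ T _ _) ⟩
    ∑ T (λ b → f zero b + ∑[ i < n ] f (suc i) b)     ∎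
    where open ≡-Reasoning

  overBool : Summation Bool
  overBool = record
    { ∑ = λ f → f true + f false
    ; ∑-cong = λ f≗g → cong₂ _+_ (f≗g true) (f≗g false)
    ; ∑-mono = λ f≤g → +-mono-≤ (f≤g true) (f≤g false)
    ; ∑-+ = λ f g → interchange (f true) (g true) (f false) (g false)
    ; ∑-*ˡ = λ c f → sym (*-distribˡ-+ c (f true) (f false)) }

  combine : ∀ {A B C} → Summation A → Summation B → (A → B → C) → Summation C
  combine S T _⊕_ = record
    { ∑ = λ f → ∑ S (λ a → ∑ T (λ b → f (a ⊕ b)))
    ; ∑-cong = λ f≗g → ∑-cong S (λ a → ∑-cong T (λ b → f≗g (a ⊕ b)))
    ; ∑-mono = λ f≤g → ∑-mono S (λ a → ∑-mono T (λ b → f≤g (a ⊕ b)))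
    ; ∑-+ = λ f g → trans (∑-cong S (λ a → ∑-+ T _ _)) (∑-+ S _ _)
    ; ∑-*ˡ = λ c f → trans (∑-cong S (λ a → ∑-*ˡ T c _)) (∑-*ˡ S c _) }

  combine-interchanges : ∀ {A B C} (S : Summation A) (T : Summation B) (_⊕_ : A → B → C) →
    Interchanges S → Interchanges T → Interchanges (combine S T _⊕_)
  combine-interchanges S T _⊕_ iS iT U f =
    trans (∑-cong S (λ a → iT U (λ b → f (a ⊕ b)))) (iS U _)

  overTuples : ∀ n j → Summation (Vec (Fin n) j)
  overTuples n zero    = atPoint []
  overTuples n (suc j) = combine (overFin n) (overTuples n j) _∷_

  overTuples-interchanges : ∀ n j → Interchanges (overTuples n j)
  overTuples-interchanges n zero    = atPoint-interchanges []
  overTuples-interchanges n (suc j) =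
    combine-interchanges (overFin n) (overTuples n j) _∷_ (overFin-interchanges n) (overTuples-interchanges n j)

  overSubsets : ∀ n → Summation (Subset n)
  overSubsets zero    = atPoint []
  overSubsets (suc n) = combine overBool (overSubsets n) _∷_

  term≤overSubsets : ∀ n (f : Subset n → ℕ) p → f p ≤ ∑ (overSubsets n) f
  term≤overSubsets zero    f []            = ≤-refl
  term≤overSubsets (suc n) f (true ∷ p)  = ≤-trans (term≤overSubsets n _ p) (m≤m+n _ _)
  term≤overSubsets (suc n) f (false ∷ p) = ≤-trans (term≤overSubsets n _ p) (m≤n+m _ _)

  count : ∀ {n ℓ} {P : Fin n → Set ℓ} → (∀ x → Dec (P x)) → ℕ
  count P? = sum (λ x → 𝟙 (P? x))

  sum-const : ∀ n c → ∑[ i < n ] c ≡ n * c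
  sum-const zero    c = refl
  sum-const (suc n) c = cong (c +_) (sum-const n c)

  sum-≥ : ∀ {n} c {f : Fin n → ℕ} → (∀ i → c ≤ f i) → n * c ≤ sum f
  sum-≥ {n} c c≤f = subst (_≤ _) (sum-const n c) (sum-mono-≤ c≤f)

  count-none : ∀ {n ℓ} {P : Fin n → Set ℓ} (P? : ∀ x → Dec (P x)) → (∀ x → ¬ P x) → count P? ≡ 0
  count-none {n} P? ¬P = trans (sum-cong-≗ (λ x → 𝟙-no (¬P x) (P? x))) (trans (sum-const n 0) (*-zeroʳ n))

  count-≡ : ∀ {n} (y : Fin n) → count (_≟ᶠ y) ≡ 1
  count-≡ {suc n} zero    = cong₂ _+_ (𝟙-yes refl (zero {n} ≟ᶠ zero)) (count-none {n} (λ i → suc i ≟ᶠ zero) (λ i ()))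
  count-≡ {suc n} (suc y) = cong₂ _+_ (𝟙-no (λ ()) (zero ≟ᶠ suc y))
    (trans (sum-cong-≗ (λ i → 𝟙-cong suc-injectiveᶠ (cong suc) (suc i ≟ᶠ suc y) (i ≟ᶠ y))) (count-≡ y))

  count-∈ : ∀ {n} (p : Subset n) → count (_∈? p) ≡ ∣ p ∣
  count-∈ []             = refl
  count-∈ (inside ∷ p)  = cong₂ _+_ (𝟙-yes here (zero ∈? (inside ∷ p)))
    (trans (sum-cong-≗ (λ x → 𝟙-cong drop-there there (suc x ∈? (inside ∷ p)) (x ∈? p))) (count-∈ p))
  count-∈ (outside ∷ p) = cong₂ _+_ (𝟙-no (λ ()) (zero ∈? (outside ∷ p)))
    (trans (sum-cong-≗ (λ x → 𝟙-cong drop-there there (suc x ∈? (outside ∷ p)) (x ∈? p))) (count-∈ p))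

  count-∉ : ∀ {n} (p : Subset n) → count (λ x → ¬? (x ∈? p)) ≡ n ∸ ∣ p ∣
  count-∉ p = begin
    count (λ x → ¬? (x ∈? p)) ≡⟨ sum-cong-≗ (λ x → 𝟙-cong x∉p⇒x∈∁p x∈∁p⇒x∉p (¬? (x ∈? p)) (x ∈? ∁ p)) ⟩
    count (_∈? ∁ p)           ≡⟨ count-∈ (∁ p) ⟩
    ∣ ∁ p ∣                   ≡⟨ ∣∁p∣≡n∸∣p∣ p ⟩
    _ ∸ ∣ p ∣                 ∎
    where open ≡-Reasoning

  count-size : ∀ n k → ∑ (overSubsets n) (λ p → 𝟙 (∣ p ∣ ≟ k)) ≡ n C k
  count-size zero    zero    = refl
  count-size zero    (suc k) = refl
  count-size (suc n) zero    =
    cong₂ _+_ (trans (∑-cong (overSubsets n) (λ p → 𝟙-no (λ ()) (suc ∣ p ∣ ≟ 0))) (∑-*ˡ (overSubsets n) 0 (λ _ → 0)))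
              (count-size n zero)
  count-size (suc n) (suc k) = begin
    ∑ Sₙ (λ p → 𝟙 (suc ∣ p ∣ ≟ suc k)) + ∑ Sₙ (λ p → 𝟙 (∣ p ∣ ≟ suc k))
      ≡⟨ cong₂ _+_ (∑-cong Sₙ (λ p → 𝟙-cong suc-injective (cong suc) (suc ∣ p ∣ ≟ suc k) (∣ p ∣ ≟ k))) (count-size n (suc k)) ⟩
    ∑ Sₙ (λ p → 𝟙 (∣ p ∣ ≟ k)) + n C suc k
      ≡⟨ cong (_+ n C suc k) (count-size n k) ⟩
    n C k + n C suc k
      ≡⟨ nCk+nC[k+1]≡[n+1]C[k+1] n k ⟩
    suc n C suc k ∎
    where
    open ≡-Reasoning
    Sₙ = overSubsets n

  k!*nCk≤n^k : ∀ n k → k ! * (n C k) ≤ n ^ k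
  k!*nCk≤n^k n k with k ≤? n
  ... | no k≰n = ≤-trans (≤-reflexive (trans (cong (k ! *_) (k>n⇒nCk≡0 (≰⇒> k≰n))) (*-zeroʳ (k !)))) z≤n
  ... | yes k≤n = begin
    k ! * (n C k)             ≡⟨ cong (k ! *_) (nCk≡nPk/k! k≤n) ⟩
    k ! * ((n P k) / k !)     ≡⟨ *-comm (k !) _ ⟩
    (n P k) / k ! * k !       ≤⟨ m/n*n≤m (n P k) (k !) ⟩
    n P k                     ≤⟨ nPk≤n^k k ⟩
    n ^ k                     ∎
    where
    open ≤-Reasoning
    instance _ = k !≢0
    nP′k≤n^k : ∀ k → n P′ k ≤ n ^ k
    nP′k≤n^k zero    = ≤-refl
    nP′k≤n^k (suc k) = *-mono-≤ (m∸n≤m n k) (nP′k≤n^k k)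
    nPk≤n^k : ∀ k → n P k ≤ n ^ k
    nPk≤n^k k with k ≤ᵇ n
    ... | true  = nP′k≤n^k k
    ... | false = z≤n


  -- Subsets

  toSubset : ∀ {n ℓ} {P : Fin n → Set ℓ} → (∀ x → Dec (P x)) → Subset n
  toSubset P? = tabulate (λ x → does (P? x))

  module _ {n ℓ} {P : Fin n → Set ℓ} (P? : ∀ x → Dec (P x)) where

    ∈-toSubset⁺ : ∀ {x} → P x → x ∈ toSubset P?
    ∈-toSubset⁺ {x} px = lookup⇒[]= x _ (trans (lookup∘tabulate _ x) (dec-true (P? x) px))

    ∈-toSubset⁻ : ∀ {x} → x ∈ toSubset P? → P x
    ∈-toSubset⁻ {x} x∈ with P? x | trans (sym (lookup∘tabulate (λ x → does (P? x)) x)) ([]=⇒lookup x∈)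
    ... | yes px | _ = px
    ... | no _   | ()

  p⊆q∧∣q∣≤∣p∣⇒q⊆p : ∀ {n} {p q : Subset n} → p ⊆ q → ∣ q ∣ ≤ ∣ p ∣ → q ⊆ p
  p⊆q∧∣q∣≤∣p∣⇒q⊆p {p = p} p⊆q ∣q∣≤∣p∣ {x} x∈q with x ∈? p
  ... | yes x∈p = x∈p
  ... | no  x∉p = contradiction (p⊂q⇒∣p∣<∣q∣ (p⊆q , x , x∈q , x∉p)) (≤⇒≯ ∣q∣≤∣p∣)

  x∉p⇒∣⁅x⁆∪p∣≡1+∣p∣ : ∀ {n} {x : Fin n} {p : Subset n} → x ∉ p → ∣ ⁅ x ⁆ ∪ p ∣ ≡ suc ∣ p ∣
  x∉p⇒∣⁅x⁆∪p∣≡1+∣p∣ {x = zero}  {inside  ∷ p} x∉p = contradiction here x∉p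
  x∉p⇒∣⁅x⁆∪p∣≡1+∣p∣ {x = zero}  {outside ∷ p} x∉p = cong (λ q → suc ∣ q ∣) (∪-identityˡ p)
  x∉p⇒∣⁅x⁆∪p∣≡1+∣p∣ {x = suc x} {inside  ∷ p} x∉p = cong suc (x∉p⇒∣⁅x⁆∪p∣≡1+∣p∣ (λ x∈p → x∉p (there x∈p)))
  x∉p⇒∣⁅x⁆∪p∣≡1+∣p∣ {x = suc x} {outside ∷ p} x∉p = x∉p⇒∣⁅x⁆∪p∣≡1+∣p∣ (λ x∈p → x∉p (there x∈p))

  _≟ˢ_ : ∀ {n} (p q : Subset n) → Dec (p ≡ q)
  _≟ˢ_ = ≡-dec _≟ᵇ_

  multiplicity : ∀ {n} → Subset n → List (Subset n) → ℕ
  multiplicity p L = ∑[ i < length L ] 𝟙 (p ≟ˢ lookupₗ L i)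

  multiplicity-∉ : ∀ {n} {p : Subset n} L → ListAll.All (p ≢_) L → multiplicity p L ≡ 0
  multiplicity-∉ []      _                  = refl
  multiplicity-∉ (q ∷ L) (p≢q ListAll.∷ p∉L) = cong₂ _+_ (𝟙-no p≢q (_ ≟ˢ q)) (multiplicity-∉ L p∉L)

  module _ {n} (k : ℕ) {P : Subset n → Set} (P? : ∀ p → Dec (P p)) where

    private
      sized? : ∀ p → Dec (∣ p ∣ ≡ k × P p)
      sized? p = ∣ p ∣ ≟ k ×-dec P? p

    multiplicity+𝟙≤𝟙 : ∀ L → Unique L → (∀ i → ∣ lookupₗ L i ∣ ≡ k × ¬ P (lookupₗ L i)) →
      ∀ p → multiplicity p L + 𝟙 (sized? p) ≤ 𝟙 (∣ p ∣ ≟ k)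
    multiplicity+𝟙≤𝟙 []      _          _     p = 𝟙-mono proj₁ (sized? p) (∣ p ∣ ≟ k)
    multiplicity+𝟙≤𝟙 (q ∷ L) (q∉L ∷ uL) edges p with p ≟ˢ q
    ... | no _     = multiplicity+𝟙≤𝟙 L uL (λ i → edges (suc i)) p
    ... | yes refl = ≤-reflexive (trans (cong₂ (λ a b → 1 + a + b) (multiplicity-∉ L q∉L) (𝟙-no (proj₂ (edges zero) ∘ proj₂) (sized? p)))
                                        (sym (𝟙-yes (proj₁ (edges zero)) (∣ p ∣ ≟ k))))

    -- a k-set is either one of the (distinct) edges or one of the counted sets, never both
    edges+count≤C : ∀ L → Unique L → (∀ i → ∣ lookupₗ L i ∣ ≡ k × ¬ P (lookupₗ L i)) →
      length L + ∑ (overSubsets n) (λ p → 𝟙 (sized? p)) ≤ n C k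
    edges+count≤C L uL edges = begin
      length L + ∑ S (λ p → 𝟙 (sized? p))
        ≤⟨ +-monoˡ-≤ _ length≤ ⟩
      ∑ S (λ p → multiplicity p L) + ∑ S (λ p → 𝟙 (sized? p))
        ≡⟨ sym (∑-+ S (λ p → multiplicity p L) (λ p → 𝟙 (sized? p))) ⟩
      ∑ S (λ p → multiplicity p L + 𝟙 (sized? p))
        ≤⟨ ∑-mono S (multiplicity+𝟙≤𝟙 L uL edges) ⟩
      ∑ S (λ p → 𝟙 (∣ p ∣ ≟ k))
        ≡⟨ count-size n k ⟩
      n C k ∎
      where
      open ≤-Reasoning
      S = overSubsets n
      length≤ : length L ≤ ∑ S (λ p → multiplicity p L)
      length≤ = begin
        length L
          ≡⟨ sym (*-identityʳ _) ⟩
        length L * 1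
          ≤⟨ sum-≥ 1 (λ i → ≤-trans (≤-reflexive (sym (𝟙-yes refl (lookupₗ L i ≟ˢ lookupₗ L i))))
                                    (term≤overSubsets n (λ p → 𝟙 (p ≟ˢ lookupₗ L i)) (lookupₗ L i))) ⟩
        ∑[ i < length L ] ∑ S (λ p → 𝟙 (p ≟ˢ lookupₗ L i))
          ≡⟨ overFin-interchanges (length L) S (λ i p → 𝟙 (p ≟ˢ lookupₗ L i)) ⟩
        ∑ S (λ p → multiplicity p L) ∎

  -- Connected components of a decidable symmetric relation

  module Components {n} (A : Fin n → Fin n → Set) (A? : ∀ u v → Dec (A u v))
                    (A-sym : ∀ {u v} → A u v → A v u) where

    Closed : Subset n → Set
    Closed R = ∀ {u v} → u ∈ R → A u v → v ∈ R

    Closed-Star : ∀ {R u v} → Closed R → u ∈ R → Star A u v → v ∈ R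
    Closed-Star closed u∈R ε        = u∈R
    Closed-Star closed u∈R (a ◅ as) = Closed-Star closed (closed u∈R a) as

    record ReachedFrom (x : Fin n) (R : Subset n) : Set where
      field
        source : x ∈ R
        reach  : ∀ {v} → v ∈ R → Star A x v

    open ReachedFrom

    Grown : Subset n → Fin n → Set
    Grown R v = v ∈ R ⊎ ∃[ u ] (u ∈ R × A u v)

    grown? : ∀ R v → Dec (Grown R v)
    grown? R v = (v ∈? R) ⊎-dec any? (λ u → (u ∈? R) ×-dec A? u v)

    grow : Subset n → Subset n
    grow R = toSubset (grown? R)

    ⊆-grow : ∀ {R} → R ⊆ grow R
    ⊆-grow x∈R = ∈-toSubset⁺ (grown? _) (inj₁ x∈R)

    grow-reachedFrom : ∀ {x R} → ReachedFrom x R → ReachedFrom x (grow R)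
    grow-reachedFrom {R = R} r = record { source = ⊆-grow (source r) ; reach = reach′ }
      where
      reach′ : ∀ {v} → v ∈ grow R → Star A _ v
      reach′ v∈ with ∈-toSubset⁻ (grown? R) v∈
      ... | inj₁ v∈R             = reach r v∈R
      ... | inj₂ (u , u∈R , a)   = reach r u∈R ◅◅ (a ◅ ε)

    ¬grow⇒closed : ∀ {R} → ∣ grow R ∣ ≤ ∣ R ∣ → Closed R
    ¬grow⇒closed {R} ∣grow∣≤ u∈R a = p⊆q∧∣q∣≤∣p∣⇒q⊆p ⊆-grow ∣grow∣≤ (∈-toSubset⁺ (grown? R) (inj₂ (_ , u∈R , a)))

    -- each step either closes R or enlarges it, and ∣ R ∣ ≤ n bounds the enlargements
    close : ∀ {x} fuel R → n < fuel + ∣ R ∣ → ReachedFrom x R → ∃[ R′ ] (ReachedFrom x R′ × Closed R′)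
    close fuel R bound r with ∣ grow R ∣ ≤? ∣ R ∣
    ... | yes ∣grow∣≤ = R , r , ¬grow⇒closed ∣grow∣≤
    close zero R bound r | no _ = contradiction (∣p∣≤n R) (<⇒≱ bound)
    close (suc fuel) R bound r | no ∣grow∣≰ =
      close fuel (grow R) (≤-trans bound (subst (_≤ fuel + ∣ grow R ∣) (+-suc fuel ∣ R ∣) (+-monoʳ-≤ fuel (≰⇒> ∣grow∣≰))))
            (grow-reachedFrom r)

    componentData : ∀ x → ∃[ R ] (ReachedFrom x R × Closed R)
    componentData x = close n ⁅ x ⁆ n<n+∣⁅x⁆∣ (record { source = x∈⁅x⁆ x ; reach = reach⁅x⁆ })
      where
      n<n+∣⁅x⁆∣ : n < n + ∣ ⁅ x ⁆ ∣
      n<n+∣⁅x⁆∣ = subst (λ m → n < n + m) (sym (∣⁅x⁆∣≡1 x)) (subst (n <_) (+-comm 1 n) ≤-refl)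
      reach⁅x⁆ : ∀ {v} → v ∈ ⁅ x ⁆ → Star A x v
      reach⁅x⁆ v∈ rewrite x∈⁅y⁆⇒x≡y x v∈ = ε

    component : Fin n → Subset n
    component x = proj₁ (componentData x)

    x∈component : ∀ x → x ∈ component x
    x∈component x = source (proj₁ (proj₂ (componentData x)))

    component-closed : ∀ x → Closed (component x)
    component-closed x = proj₂ (proj₂ (componentData x))

    component-connected : ∀ x {u v} → u ∈ component x → v ∈ component x → Star A u v
    component-connected x u∈ v∈ = reverse A-sym (reach r u∈) ◅◅ reach r v∈
      where r = proj₁ (proj₂ (componentData x))

    component-sym : ∀ {x y} → y ∈ component x → x ∈ component y
    component-sym {x} {y} y∈ = Closed-Star (component-closed y) (x∈component y) (component-connected x y∈ (x∈component x))

    component-trans : ∀ {x y z} → y ∈ component x → z ∈ component y → z ∈ component x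
    component-trans {x} {y} y∈ z∈ = Closed-Star (component-closed x) y∈ (component-connected y (x∈component y) z∈)

  -- Counting split k-sets

  module ApartPairs {n} {_≈₀_ _≈₁_ : Rel (Fin n) 0ℓ}
                    (E₀ : IsDecEquivalence _≈₀_) (E₁ : IsDecEquivalence _≈₁_) where

    open IsDecEquivalence E₀ using () renaming (_≟_ to _≈₀?_; sym to sym₀; trans to trans₀)
    open IsDecEquivalence E₁ using () renaming (_≟_ to _≈₁?_; trans to trans₁)

    Apart : Fin n → Fin n → Set
    Apart x y = ¬ x ≈₀ y × ¬ x ≈₁ y

    apart? : ∀ x y → Dec (Apart x y)
    apart? x y = ¬? (x ≈₀? y) ×-dec ¬? (x ≈₁? y)

    apartPairs : ℕ
    apartPairs = ∑[ x < n ] count (apart? x)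

    apart-triangle : ∀ {x y z} → ¬ x ≈₀ y → ¬ x ≈₁ z → Apart x y ⊎ Apart x z ⊎ Apart y z
    apart-triangle {x} {y} {z} x≉₀y x≉₁z with x ≈₁? y | x ≈₀? z
    ... | no x≉₁y  | _        = inj₁ (x≉₀y , x≉₁y)
    ... | yes _    | no x≉₀z  = inj₂ (inj₁ (x≉₀z , x≉₁z))
    ... | yes x≈₁y | yes x≈₀z = inj₂ (inj₂ ((λ y≈₀z → x≉₀y (trans₀ x≈₀z (sym₀ y≈₀z)))
                                          , (λ y≈₁z → x≉₁z (trans₁ x≈₁y y≈₁z))))

    apart-triangle-𝟙 : ∀ x y z → 𝟙 (¬? (x ≈₀? y)) * 𝟙 (¬? (x ≈₁? z)) ≤ 𝟙 (apart? x y) + (𝟙 (apart? x z) + 𝟙 (apart? y z))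
    apart-triangle-𝟙 x y z = ≤-trans (𝟙-*-≤ apart-triangle (¬? (x ≈₀? y)) (¬? (x ≈₁? z)) xy⊎xz⊎yz)
                                     (≤-trans (𝟙-⊎ id xy⊎xz⊎yz (apart? x y) (apart? x z ⊎-dec apart? y z))
                                              (+-monoʳ-≤ (𝟙 (apart? x y)) (𝟙-⊎ id _ (apart? x z) (apart? y z))))
      where xy⊎xz⊎yz = apart? x y ⊎-dec (apart? x z ⊎-dec apart? y z)

    private
      a : Fin n → Fin n → ℕ
      a x y = 𝟙 (apart? x y)

    sum-apart-triangle : ∑[ x < n ] ∑[ y < n ] ∑[ z < n ] (a x y + (a x z + a y z)) ≡ n * (3 * apartPairs)
    sum-apart-triangle = begin
      ∑[ x < n ] ∑[ y < n ] ∑[ z < n ] (a x y + (a x z + a y z))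
        ≡⟨ sum-cong-≗ (λ x → sum-cong-≗ (λ y → trans (∑-distrib-+ (λ _ → a x y) (λ z → a x z + a y z))
                                                     (cong₂ _+_ (sum-const n (a x y)) (∑-distrib-+ (a x) (a y))))) ⟩
      ∑[ x < n ] ∑[ y < n ] (n * a x y + (N x + N y))
        ≡⟨ sum-cong-≗ (λ x → trans (∑-distrib-+ (λ y → n * a x y) (λ y → N x + N y))
                                   (cong₂ _+_ (sym (*-distribˡ-sum n (a x)))
                                              (trans (∑-distrib-+ (λ _ → N x) N) (cong (_+ apartPairs) (sum-const n (N x)))))) ⟩
      ∑[ x < n ] (n * N x + (n * N x + apartPairs))
        ≡⟨ trans (∑-distrib-+ (λ x → n * N x) (λ x → n * N x + apartPairs))
                 (cong₂ _+_ (sym (*-distribˡ-sum n N))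
                            (trans (∑-distrib-+ (λ x → n * N x) (λ _ → apartPairs))
                                   (cong₂ _+_ (sym (*-distribˡ-sum n N)) (sum-const n apartPairs)))) ⟩
      n * apartPairs + (n * apartPairs + n * apartPairs)
        ≡⟨ thrice n apartPairs ⟩
      n * (3 * apartPairs) ∎
      where
      open ≡-Reasoning
      N : Fin n → ℕ
      N x = count (apart? x)
      thrice : ∀ m k → m * k + (m * k + m * k) ≡ m * (3 * k)
      thrice = solve-∀

    -- double counting: for each x there are ≥ d * d pairs (y, z) with x ≉₀ y and x ≉₁ z,
    -- and each of them makes one of the pairs xy, xz, yz apart
    apartPairs-≥ : ∀ {d} .{{_ : NonZero n}} →
      (∀ x → d ≤ count (λ y → ¬? (x ≈₀? y))) → (∀ x → d ≤ count (λ y → ¬? (x ≈₁? y))) → d * d ≤ 3 * apartPairs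
    apartPairs-≥ {d} d≤u₀ d≤u₁ = *-cancelˡ-≤ n (begin
      n * (d * d)
        ≤⟨ sum-≥ (d * d) (λ x → *-mono-≤ (d≤u₀ x) (d≤u₁ x)) ⟩
      ∑[ x < n ] (count (λ y → ¬? (x ≈₀? y)) * count (λ z → ¬? (x ≈₁? z)))
        ≡⟨ sum-cong-≗ (λ x → trans (*-distribʳ-sum (u₁ x) (λ y → 𝟙 (¬? (x ≈₀? y))))
                                   (sum-cong-≗ (λ y → *-distribˡ-sum (𝟙 (¬? (x ≈₀? y))) (λ z → 𝟙 (¬? (x ≈₁? z)))))) ⟩
      ∑[ x < n ] ∑[ y < n ] ∑[ z < n ] (𝟙 (¬? (x ≈₀? y)) * 𝟙 (¬? (x ≈₁? z)))
        ≤⟨ sum-mono-≤ (λ x → sum-mono-≤ (λ y → sum-mono-≤ (λ z → apart-triangle-𝟙 x y z))) ⟩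
      ∑[ x < n ] ∑[ y < n ] ∑[ z < n ] (a x y + (a x z + a y z))
        ≡⟨ sum-apart-triangle ⟩
      n * (3 * apartPairs) ∎)
      where
      open ≤-Reasoning
      u₁ : Fin n → ℕ
      u₁ x = count (λ z → ¬? (x ≈₁? z))

  falling : ℕ → ℕ → ℕ
  falling a zero    = 1
  falling a (suc j) = a * falling (a ∸ 1) j

  falling-mono : ∀ j {a b} → a ≤ b → falling a j ≤ falling b j
  falling-mono zero    a≤b = ≤-refl
  falling-mono (suc j) a≤b = *-mono-≤ a≤b (falling-mono j (∸-monoˡ-≤ 1 a≤b))

  falling-self : ∀ a → falling a a ≡ a !
  falling-self zero    = refl
  falling-self (suc a) = cong (suc a *_) (falling-self a)

  module Tuples (n : ℕ) where

    NotIn : Fin n → List (Fin n) → Set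
    NotIn y F = ListAll.All (y ≢_) F

    notIn? : ∀ y F → Dec (NotIn y F)
    notIn? y F = ListAll.all? (λ f → ¬? (y ≟ᶠ f)) F

    Fresh : ∀ {j} → List (Fin n) → Vec (Fin n) j → Set
    Fresh F []       = ⊤
    Fresh F (y ∷ ys) = NotIn y F × Fresh (y ∷ F) ys

    fresh? : ∀ {j} F (ys : Vec (Fin n) j) → Dec (Fresh F ys)
    fresh? F []       = yes tt
    fresh? F (y ∷ ys) = notIn? y F ×-dec fresh? (y ∷ F) ys

    Fresh⇒NotIn : ∀ {j F} (ys : Vec (Fin n) j) → Fresh F ys → VecAll.All (λ y → NotIn y F) ys
    Fresh⇒NotIn []       _            = VecAll.[]
    Fresh⇒NotIn (y ∷ ys) (y∉F , fresh) = y∉F VecAll.∷ VecAll.map ListAll.tail (Fresh⇒NotIn ys fresh)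

    Fresh⇒≢ : ∀ {j x F} (ys : Vec (Fin n) j) → Fresh (x ∷ F) ys → VecAll.All (_≢ x) ys
    Fresh⇒≢ ys fresh = VecAll.map ListAll.head (Fresh⇒NotIn ys fresh)

    AllAt : ∀ {j} → (Fin j → Fin n → Set) → Vec (Fin n) j → Set
    AllAt Q []       = ⊤
    AllAt Q (y ∷ ys) = Q zero y × AllAt (λ i → Q (suc i)) ys

    allAt? : ∀ {j} {Q : Fin j → Fin n → Set} → (∀ i y → Dec (Q i y)) → ∀ ys → Dec (AllAt Q ys)
    allAt? Q? []       = yes tt
    allAt? Q? (y ∷ ys) = Q? zero y ×-dec allAt? (λ i → Q? (suc i)) ys

    AllAt-lookup : ∀ {j} {Q : Fin j → Fin n → Set} ys → AllAt Q ys → ∀ i → Q i (lookup ys i)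
    AllAt-lookup (y ∷ ys) (q , _)  zero    = q
    AllAt-lookup (y ∷ ys) (_ , qs) (suc i) = AllAt-lookup ys qs i

    count-¬NotIn : ∀ F → count (λ y → ¬? (notIn? y F)) ≤ length F
    count-¬NotIn []      = ≤-reflexive (count-none (λ y → ¬? (notIn? y [])) (λ y y∈[] → y∈[] ListAll.[]))
    count-¬NotIn (f ∷ F) = begin
      count (λ y → ¬? (notIn? y (f ∷ F)))
        ≤⟨ sum-mono-≤ (λ y → 𝟙-⊎ (¬NotIn-∷ y) (¬? (notIn? y (f ∷ F))) (y ≟ᶠ f) (¬? (notIn? y F))) ⟩
      ∑[ y < n ] (𝟙 (y ≟ᶠ f) + 𝟙 (¬? (notIn? y F)))
        ≡⟨ ∑-distrib-+ (λ y → 𝟙 (y ≟ᶠ f)) (λ y → 𝟙 (¬? (notIn? y F))) ⟩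
      count (_≟ᶠ f) + count (λ y → ¬? (notIn? y F))
        ≤⟨ +-mono-≤ (≤-reflexive (count-≡ f)) (count-¬NotIn F) ⟩
      suc (length F) ∎
      where
      open ≤-Reasoning
      ¬NotIn-∷ : ∀ y → ¬ NotIn y (f ∷ F) → y ≡ f ⊎ ¬ NotIn y F
      ¬NotIn-∷ y y∈f∷F with y ≟ᶠ f
      ... | yes y≡f = inj₁ y≡f
      ... | no  y≢f = inj₂ (λ y∉F → y∈f∷F (y≢f ListAll.∷ y∉F))

    count-≤-NotIn : ∀ {P : Fin n → Set} (P? : ∀ y → Dec (P y)) F →
      count P? ≤ length F + count (λ y → P? y ×-dec notIn? y F)
    count-≤-NotIn P? F = begin
      count P?
        ≤⟨ sum-mono-≤ (λ y → 𝟙-⊎ (inF⊎NotIn y) (P? y) (¬? (notIn? y F)) (P? y ×-dec notIn? y F)) ⟩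
      ∑[ y < n ] (𝟙 (¬? (notIn? y F)) + 𝟙 (P? y ×-dec notIn? y F))
        ≡⟨ ∑-distrib-+ (λ y → 𝟙 (¬? (notIn? y F))) (λ y → 𝟙 (P? y ×-dec notIn? y F)) ⟩
      count (λ y → ¬? (notIn? y F)) + count (λ y → P? y ×-dec notIn? y F)
        ≤⟨ +-monoˡ-≤ _ (count-¬NotIn F) ⟩
      length F + count (λ y → P? y ×-dec notIn? y F) ∎
      where
      open ≤-Reasoning
      inF⊎NotIn : ∀ y → _ → ¬ NotIn y F ⊎ (_ × NotIn y F)
      inF⊎NotIn y p with notIn? y F
      ... | yes y∉F = inj₂ (p , y∉F)
      ... | no  y∈F = inj₁ y∈F

    -- every entry has at least d ∸ (length F + j) admissible values
    freshTuples-≥ : ∀ j {Q : Fin j → Fin n → Set} (Q? : ∀ i y → Dec (Q i y)) F {d} →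
      (∀ i → d ≤ count (Q? i)) →
      (d ∸ (length F + j)) ^ j ≤ ∑ (overTuples n j) (λ ys → 𝟙 (allAt? Q? ys ×-dec fresh? F ys))
    freshTuples-≥ zero    Q? F d≤ = ≤-reflexive (sym (𝟙-yes (tt , tt) (allAt? Q? [] ×-dec fresh? F [])))
    freshTuples-≥ (suc j) Q? F {d} d≤ = begin
      (d ∸ (length F + suc j)) ^ suc j
        ≡⟨ cong (λ m → (d ∸ (length F + suc j)) * (d ∸ m) ^ j) (+-suc (length F) j) ⟩
      (d ∸ (length F + suc j)) * R
        ≤⟨ *-monoˡ-≤ R (∸-monoʳ-≤ d (m≤m+n (length F) (suc j))) ⟩
      (d ∸ length F) * R
        ≤⟨ *-monoˡ-≤ R (m≤n+o⇒m∸n≤o d (length F) (≤-trans (d≤ zero) (count-≤-NotIn (Q? zero) F))) ⟩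
      count first? * R
        ≡⟨ *-distribʳ-sum R (λ y → 𝟙 (first? y)) ⟩
      ∑[ y < n ] (𝟙 (first? y) * R)
        ≤⟨ sum-mono-≤ (λ y → *-monoʳ-≤ (𝟙 (first? y)) (freshTuples-≥ j (λ i → Q? (suc i)) (y ∷ F) (λ i → d≤ (suc i)))) ⟩
      ∑[ y < n ] (𝟙 (first? y) * ∑ (overTuples n j) (λ ys → 𝟙 (rest? y ys)))
        ≡⟨ sum-cong-≗ (λ y → trans (sym (∑-*ˡ (overTuples n j) (𝟙 (first? y)) (λ ys → 𝟙 (rest? y ys))))
                                   (∑-cong (overTuples n j) (λ ys → sym (split y ys)))) ⟩
      ∑ (overTuples n (suc j)) (λ ys → 𝟙 (allAt? Q? ys ×-dec fresh? F ys)) ∎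
      where
      open ≤-Reasoning
      R = (d ∸ (suc (length F) + j)) ^ j
      first? : ∀ y → Dec _
      first? y = Q? zero y ×-dec notIn? y F
      rest? : ∀ y ys → Dec _
      rest? y ys = allAt? (λ i → Q? (suc i)) ys ×-dec fresh? (y ∷ F) ys
      split : ∀ y ys → 𝟙 (allAt? Q? (y ∷ ys) ×-dec fresh? F (y ∷ ys)) ≡ 𝟙 (first? y) * 𝟙 (rest? y ys)
      split y ys = trans (𝟙-cong (λ { ((q , qs) , (y∉F , fresh)) → (q , y∉F) , (qs , fresh) })
                                 (λ { ((q , y∉F) , (qs , fresh)) → (q , qs) , (y∉F , fresh) })
                                 _ (first? y ×-dec rest? y ys))
                         (𝟙-× (first? y) (rest? y ys) _)

    img : ∀ {j} → Vec (Fin n) j → Subset n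
    img []       = ∅
    img (y ∷ ys) = ⁅ y ⁆ ∪ img ys

    lookup∈img : ∀ {j} (ys : Vec (Fin n) j) i → lookup ys i ∈ img ys
    lookup∈img (y ∷ ys) zero    = x∈p∪q⁺ (inj₁ (x∈⁅x⁆ y))
    lookup∈img (y ∷ ys) (suc i) = x∈p∪q⁺ (inj₂ (lookup∈img ys i))

    AllIn : ∀ {j} → Subset n → Vec (Fin n) j → Set
    AllIn p ys = VecAll.All (_∈ p) ys

    allIn? : ∀ {j} p (ys : Vec (Fin n) j) → Dec (AllIn p ys)
    allIn? p ys = VecAll.all? (_∈? p) ys

    AllIn-img : ∀ {j} (ys : Vec (Fin n) j) → AllIn (img ys) ys
    AllIn-img []       = VecAll.[]
    AllIn-img (y ∷ ys) = x∈p∪q⁺ (inj₁ (x∈⁅x⁆ y)) VecAll.∷ VecAll.map (λ z∈ys → x∈p∪q⁺ (inj₂ z∈ys)) (AllIn-img ys)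

    ∉img : ∀ {j x} (ys : Vec (Fin n) j) → VecAll.All (_≢ x) ys → x ∉ img ys
    ∉img []       _                    x∈∅   = ∉⊥ x∈∅
    ∉img (y ∷ ys) (y≢x VecAll.∷ ys≢x) x∈img with x∈p∪q⁻ ⁅ y ⁆ (img ys) x∈img
    ... | inj₁ x∈⁅y⁆ = y≢x (sym (x∈⁅y⁆⇒x≡y y x∈⁅y⁆))
    ... | inj₂ x∈ys  = ∉img ys ys≢x x∈ys

    ∣img∣ : ∀ {j F} (ys : Vec (Fin n) j) → Fresh F ys → ∣ img ys ∣ ≡ j
    ∣img∣ []       _           = ∣⊥∣≡0 n
    ∣img∣ (y ∷ ys) (_ , fresh) = trans (x∉p⇒∣⁅x⁆∪p∣≡1+∣p∣ (∉img ys (Fresh⇒≢ ys fresh))) (cong suc (∣img∣ ys fresh))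

    AllIn-minus : ∀ {j x p} (ys : Vec (Fin n) j) → VecAll.All (_≢ x) ys → AllIn p ys → AllIn (p - x) ys
    AllIn-minus []       _                    _                  = VecAll.[]
    AllIn-minus (y ∷ ys) (y≢x VecAll.∷ ys≢x) (y∈p VecAll.∷ ys⊆p) =
      x∈p∧x≢y⇒x∈p-y y∈p y≢x VecAll.∷ AllIn-minus ys ys≢x ys⊆p

    freshIn-≤ : ∀ j F (p : Subset n) → ∑ (overTuples n j) (λ ys → 𝟙 (fresh? F ys ×-dec allIn? p ys)) ≤ falling ∣ p ∣ j
    freshIn-≤ zero    F p = 𝟙≤1 (fresh? F [] ×-dec allIn? p [])
    freshIn-≤ (suc j) F p = begin
      ∑[ x < n ] ∑ T (λ ys → 𝟙 (fresh? F (x ∷ ys) ×-dec allIn? p (x ∷ ys)))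
        ≤⟨ sum-mono-≤ (λ x → ∑-mono T (λ ys → ≤-trans (𝟙-mono (peel x ys) _ (x ∈? p ×-dec rest? x ys))
                                                      (≤-reflexive (𝟙-× (x ∈? p) (rest? x ys) _)))) ⟩
      ∑[ x < n ] ∑ T (λ ys → 𝟙 (x ∈? p) * 𝟙 (rest? x ys))
        ≡⟨ sum-cong-≗ (λ x → ∑-*ˡ T (𝟙 (x ∈? p)) (λ ys → 𝟙 (rest? x ys))) ⟩
      ∑[ x < n ] (𝟙 (x ∈? p) * ∑ T (λ ys → 𝟙 (rest? x ys)))
        ≤⟨ sum-mono-≤ (λ x → bound x (x ∈? p)) ⟩
      ∑[ x < n ] (𝟙 (x ∈? p) * falling (∣ p ∣ ∸ 1) j)
        ≡⟨ sym (*-distribʳ-sum (falling (∣ p ∣ ∸ 1) j) (λ x → 𝟙 (x ∈? p))) ⟩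
      count (_∈? p) * falling (∣ p ∣ ∸ 1) j
        ≡⟨ cong (_* falling (∣ p ∣ ∸ 1) j) (count-∈ p) ⟩
      falling ∣ p ∣ (suc j) ∎
      where
      open ≤-Reasoning
      T = overTuples n j
      rest? : ∀ x ys → Dec _
      rest? x ys = fresh? (x ∷ F) ys ×-dec allIn? (p - x) ys
      peel : ∀ x ys → Fresh F (x ∷ ys) × AllIn p (x ∷ ys) → x ∈ p × (Fresh (x ∷ F) ys × AllIn (p - x) ys)
      peel x ys ((_ , fresh) , (x∈p VecAll.∷ ys⊆p)) = x∈p , fresh , AllIn-minus ys (Fresh⇒≢ ys fresh) ys⊆p
      bound : ∀ x (x∈?p : Dec (x ∈ p)) → 𝟙 x∈?p * ∑ T (λ ys → 𝟙 (rest? x ys)) ≤ 𝟙 x∈?p * falling (∣ p ∣ ∸ 1) j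
      bound x (no _)    = z≤n
      bound x (yes x∈p) = *-monoʳ-≤ 1 (≤-trans (freshIn-≤ j (x ∷ F) (p - x))
                                               (falling-mono j (∸-monoˡ-≤ 1 (x∈p⇒∣p-x∣<∣p∣ x∈p))))

    freshTuples≤k!*subsets : ∀ k {P : Subset n → Set} (P? : ∀ p → Dec (P p)) →
      ∑ (overTuples n k) (λ ys → 𝟙 (fresh? [] ys ×-dec P? (img ys)))
        ≤ k ! * ∑ (overSubsets n) (λ p → 𝟙 (∣ p ∣ ≟ k ×-dec P? p))
    freshTuples≤k!*subsets k {P} P? = begin
      ∑ T (λ ys → 𝟙 (fresh? [] ys ×-dec P? (img ys)))
        ≤⟨ ∑-mono T (λ ys → lift ys (fresh? [] ys ×-dec P? (img ys))) ⟩
      ∑ T (λ ys → ∑ S (λ p → 𝟙 (sized? p) * 𝟙 (inside? p ys)))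
        ≡⟨ overTuples-interchanges n k S (λ ys p → 𝟙 (sized? p) * 𝟙 (inside? p ys)) ⟩
      ∑ S (λ p → ∑ T (λ ys → 𝟙 (sized? p) * 𝟙 (inside? p ys)))
        ≡⟨ ∑-cong S (λ p → ∑-*ˡ T (𝟙 (sized? p)) (λ ys → 𝟙 (inside? p ys))) ⟩
      ∑ S (λ p → 𝟙 (sized? p) * ∑ T (λ ys → 𝟙 (inside? p ys)))
        ≤⟨ ∑-mono S (λ p → bound p (sized? p)) ⟩
      ∑ S (λ p → k ! * 𝟙 (sized? p))
        ≡⟨ ∑-*ˡ S (k !) (λ p → 𝟙 (sized? p)) ⟩
      k ! * ∑ S (λ p → 𝟙 (sized? p)) ∎
      where
      open ≤-Reasoning
      T = overTuples n k
      S = overSubsets n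
      sized? : ∀ p → Dec (∣ p ∣ ≡ k × P p)
      sized? p = ∣ p ∣ ≟ k ×-dec P? p
      inside? : ∀ p ys → Dec (Fresh [] ys × AllIn p ys)
      inside? p ys = fresh? [] ys ×-dec allIn? p ys
      lift : ∀ ys (d : Dec (Fresh [] ys × P (img ys))) → 𝟙 d ≤ ∑ S (λ p → 𝟙 (sized? p) * 𝟙 (inside? p ys))
      lift ys (no _)              = z≤n
      lift ys (yes (fresh , Pys)) = ≤-trans
        (≤-reflexive (sym (cong₂ _*_ (𝟙-yes (∣img∣ ys fresh , Pys) (sized? (img ys))) (𝟙-yes (fresh , AllIn-img ys) (inside? (img ys) ys)))))
        (term≤overSubsets n (λ p → 𝟙 (sized? p) * 𝟙 (inside? p ys)) (img ys))
      bound : ∀ p (d : Dec (∣ p ∣ ≡ k × P p)) → 𝟙 d * ∑ T (λ ys → 𝟙 (inside? p ys)) ≤ k ! * 𝟙 d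
      bound p (no _)          = ≤-reflexive (sym (*-zeroʳ (k !)))
      bound p (yes (∣p∣≡k , _)) = begin
        ∑ T (λ ys → 𝟙 (inside? p ys)) + 0 ≡⟨ +-identityʳ _ ⟩
        ∑ T (λ ys → 𝟙 (inside? p ys))     ≤⟨ freshIn-≤ k [] p ⟩
        falling ∣ p ∣ k                    ≡⟨ cong (λ m → falling m k) ∣p∣≡k ⟩
        falling k k                        ≡⟨ falling-self k ⟩
        k !                                ≡⟨ sym (*-identityʳ (k !)) ⟩
        k ! * 1 ∎

  module Splitting {n m} .{{_ : NonZero n}} (same : Fin (suc (suc m)) → Rel (Fin n) 0ℓ)
                   (isDecEquiv : ∀ c → IsDecEquivalence (same c)) {d}
                   (d≤ : ∀ c x → d ≤ count (λ y → ¬? (IsDecEquivalence._≟_ (isDecEquiv c) x y))) where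

    open Tuples n
    open ApartPairs (isDecEquiv zero) (isDecEquiv (suc zero))

    k : ℕ
    k = suc (suc m)

    Split : Subset n → Set
    Split p = ∀ c → ∃[ u ] ∃[ v ] (u ∈ p × v ∈ p × ¬ same c u v)

    split? : ∀ p → Dec (Split p)
    split? p = all? λ c → any? λ u → any? λ v →
      u ∈? p ×-dec v ∈? p ×-dec ¬? (IsDecEquivalence._≟_ (isDecEquiv c) u v)

    splitSets : ℕ
    splitSets = ∑ (overSubsets n) (λ p → 𝟙 (∣ p ∣ ≟ k ×-dec split? p))

    splitTuples : ℕ
    splitTuples = ∑ (overTuples n k) (λ ys → 𝟙 (fresh? [] ys ×-dec split? (img ys)))

    Avoids : Fin n → Fin m → Fin n → Set
    Avoids a i y = ¬ same (suc (suc i)) a y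

    avoids? : ∀ a i y → Dec (Avoids a i y)
    avoids? a i y = ¬? (IsDecEquivalence._≟_ (isDecEquiv (suc (suc i))) a y)

    apart-extension-split : ∀ {a b} ys → Apart a b → AllAt (Avoids a) ys × Fresh (b ∷ a ∷ []) ys →
      Fresh [] (a ∷ b ∷ ys) × Split (img (a ∷ b ∷ ys))
    apart-extension-split {a} {b} ys (a≉₀b , a≉₁b) (avoids , fresh) = (ListAll.[] , (b≢a ListAll.∷ ListAll.[]) , fresh) , split
      where
      t = a ∷ b ∷ ys
      b≢a : b ≢ a
      b≢a refl = a≉₀b (IsDecEquivalence.refl (isDecEquiv zero))
      split : Split (img t)
      split zero          = a , b , lookup∈img t zero , lookup∈img t (suc zero) , a≉₀b
      split (suc zero)    = a , b , lookup∈img t zero , lookup∈img t (suc zero) , a≉₁b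
      split (suc (suc i)) = a , lookup ys i , lookup∈img t zero , lookup∈img t (suc (suc i)) , AllAt-lookup ys avoids i

    splitTuples-≥ : apartPairs * (d ∸ k) ^ m ≤ splitTuples
    splitTuples-≥ = begin
      apartPairs * E
        ≡⟨ *-distribʳ-sum E (λ a → count (apart? a)) ⟩
      ∑[ a < n ] (count (apart? a) * E)
        ≡⟨ sum-cong-≗ (λ a → *-distribʳ-sum E (λ b → 𝟙 (apart? a b))) ⟩
      ∑[ a < n ] ∑[ b < n ] (𝟙 (apart? a b) * E)
        ≤⟨ sum-mono-≤ (λ a → sum-mono-≤ (λ b → *-monoʳ-≤ (𝟙 (apart? a b))
             (freshTuples-≥ m (avoids? a) (b ∷ a ∷ []) (λ i → d≤ (suc (suc i)) a)))) ⟩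
      ∑[ a < n ] ∑[ b < n ] (𝟙 (apart? a b) * ∑ Tₘ (λ ys → 𝟙 (extension? a b ys)))
        ≡⟨ sum-cong-≗ (λ a → sum-cong-≗ (λ b → sym (∑-*ˡ Tₘ (𝟙 (apart? a b)) (λ ys → 𝟙 (extension? a b ys))))) ⟩
      ∑[ a < n ] ∑[ b < n ] ∑ Tₘ (λ ys → 𝟙 (apart? a b) * 𝟙 (extension? a b ys))
        ≤⟨ sum-mono-≤ (λ a → sum-mono-≤ (λ b → ∑-mono Tₘ (λ ys →
             𝟙-*-≤ (apart-extension-split ys) (apart? a b) (extension? a b ys) (fresh? [] (a ∷ b ∷ ys) ×-dec split? (img (a ∷ b ∷ ys)))))) ⟩
      splitTuples ∎
      where
      open ≤-Reasoning
      E = (d ∸ k) ^ m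
      Tₘ = overTuples n m
      extension? : ∀ a b ys → Dec _
      extension? a b ys = allAt? (avoids? a) ys ×-dec fresh? (b ∷ a ∷ []) ys

    splitSets-≥ : d * d * (d ∸ k) ^ m ≤ 3 * (k ! * splitSets)
    splitSets-≥ = begin
      d * d * E            ≤⟨ *-monoˡ-≤ E (apartPairs-≥ (d≤ zero) (d≤ (suc zero))) ⟩
      3 * apartPairs * E   ≡⟨ *-assoc 3 apartPairs E ⟩
      3 * (apartPairs * E) ≤⟨ *-monoʳ-≤ 3 (≤-trans splitTuples-≥ (freshTuples≤k!*subsets k split?)) ⟩
      3 * (k ! * splitSets) ∎
      where
      open ≤-Reasoning
      E = (d ∸ k) ^ m

  -- Colourings of a hypergraph

  -- opaque, or conversion checking unfolds the fold over allFin
  opaque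
    argmax : ∀ {n} (f : Fin (suc n) → ℕ) → ∃[ i ] (∀ j → f j ≤ f i)
    argmax {n} f = Extrema.argmax f zero (allFin (suc n)) ,
      λ j → ListAll.lookup (f[xs]≤f[argmax] {f = f} zero (allFin (suc n))) (∈-allFin j)

  argmax₂ : ∀ {m n} (f : Fin (suc m) → Fin (suc n) → ℕ) → ∃[ i ] ∃[ j ] (∀ i′ j′ → f i′ j′ ≤ f i j)
  argmax₂ f = i , best i , λ i′ j′ → ≤-trans (proj₂ (argmax (f i′)) j′) (proj₂ outer i′)
    where
    best = λ i → proj₁ (argmax (f i))
    outer = argmax (λ i → f i (best i))
    i = proj₁ outer

  module ColourClasses {k n r} (G : Hypergraph k n) (χ : Colouring G r) where

    adj? : ∀ c u v → Dec (Adj G χ c u v)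
    adj? c u v = any? (λ i → (χ i ≟ᶠ c) ×-dec (u ∈? lookupₗ (edges G) i ×-dec v ∈? lookupₗ (edges G) i))

    adj-sym : ∀ {c u v} → Adj G χ c u v → Adj G χ c v u
    adj-sym (i , χi≡c , u∈eᵢ , v∈eᵢ) = i , χi≡c , v∈eᵢ , u∈eᵢ

    module _ (c : Fin r) where
      open Components (Adj G χ c) (adj? c) adj-sym public

    component-isComponent : ∀ c x → IsComponent G χ c (component c x)
    component-isComponent c x =
      (x , x∈component c x) , (λ _ _ → component-connected c x) , (λ _ _ → component-closed c x)

    sameComponent : Fin r → Rel (Fin n) 0ℓ
    sameComponent c x y = y ∈ component c x

    sameComponent-isDecEquivalence : ∀ c → IsDecEquivalence (sameComponent c)
    sameComponent-isDecEquivalence c = record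
      { isEquivalence = record
        { refl  = x∈component c _
        ; sym   = component-sym c
        ; trans = λ y∈ z∈ → component-trans c y∈ z∈ }
      ; _≟_ = λ x y → y ∈? component c x }

    edge⊆component : ∀ i {u v} → u ∈ lookupₗ (edges G) i → v ∈ lookupₗ (edges G) i → sameComponent (χ i) u v
    edge⊆component i {u} u∈eᵢ v∈eᵢ = component-closed (χ i) u (x∈component (χ i) u) (i , refl , u∈eᵢ , v∈eᵢ)

  largestComponent-splitSets : ∀ {m n} (G : Hypergraph (suc (suc m)) (suc n)) (χ : Colouring G (suc (suc m))) →
    ∃[ c ] ∃[ S ] (IsComponent G χ c S × ∃[ s ] (e G + s ≤ suc n C suc (suc m)
      × (suc n ∸ ∣ S ∣) * (suc n ∸ ∣ S ∣) * ((suc n ∸ ∣ S ∣) ∸ suc (suc m)) ^ m ≤ 3 * (suc (suc m) ! * s)))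
  largestComponent-splitSets {m} {n} G χ = c , S , component-isComponent c x , splitSets , edges+split≤C , splitSets-≥
    where
    open ColourClasses G χ
    largest = argmax₂ (λ c x → ∣ component c x ∣)
    c = proj₁ largest
    x = proj₁ (proj₂ largest)
    S = component c x
    outside-≥ : ∀ c′ x′ → suc n ∸ ∣ S ∣ ≤ count (λ y → ¬? (y ∈? component c′ x′))
    outside-≥ c′ x′ = subst (suc n ∸ ∣ S ∣ ≤_) (sym (count-∉ (component c′ x′))) (∸-monoʳ-≤ (suc n) (proj₂ (proj₂ largest) c′ x′))
    open Splitting sameComponent sameComponent-isDecEquivalence outside-≥
    edge-unsplit : ∀ i → ¬ Split (lookupₗ (edges G) i)
    edge-unsplit i split with split (χ i)
    ... | u , v , u∈eᵢ , v∈eᵢ , u≁v = u≁v (edge⊆component i u∈eᵢ v∈eᵢ)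
    edges+split≤C : e G + splitSets ≤ suc n C suc (suc m)
    edges+split≤C = edges+count≤C k split? (edges G) (unique G)
      (λ i → ListAll.lookup (uniform G) (∈-lookup i) , edge-unsplit i)

module Estimates where

  open import Defs using (ℝ; ℕ→ℚ; _^ℚ_; L-lower; disjoint)
  open import Data.Nat as ℕ using (ℕ; zero; suc; _!)
  open import Data.Nat.Combinatorics using (_C_)
  open Counting using (k!*nCk≤n^k)
  import Data.Nat.Properties as ℕ
  open import Data.Integer as ℤ using (+_)
  import Data.Integer.Properties as ℤ
  open import Data.Rational as ℚ using (ℚ; mkℚ; 0ℚ; 1ℚ; _+_; _*_; _-_; _≤_; _<_)
  open import Data.Rational.Properties
  import Data.Rational.Unnormalised as ℚᵘ
  import Data.Rational.Unnormalised.Properties as ℚᵘ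
  open import Data.Rational.Solver using (module +-*-Solver)
  open +-*-Solver
  import Data.Nat.Coprimality as Coprimality
  open import Data.Product using (∃-syntax; _,_)
  open import Relation.Binary.PropositionalEquality
  open import Relation.Binary.Definitions using (tri<; tri≈; tri>)
  open import Relation.Nullary using (contradiction)

  ι : ℕ → ℚ
  ι = ℕ→ℚ

  ι≡mkℚ : ∀ n → ι n ≡ mkℚ (+ n) 0 (Coprimality.sym (Coprimality.1-coprimeTo n))
  ι≡mkℚ n = normalize-coprime (Coprimality.sym (Coprimality.1-coprimeTo n))

  ι-homo-+ : ∀ a b → ι (a ℕ.+ b) ≡ ι a + ι b
  ι-homo-+ a b = trans (/-cong {+ (a ℕ.+ b)} {1} {+ a ℤ.* + 1 ℤ.+ + b ℤ.* + 1} {1} numerators refl)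
                       (sym (cong₂ _+_ (ι≡mkℚ a) (ι≡mkℚ b)))
    where
    numerators : + (a ℕ.+ b) ≡ + a ℤ.* + 1 ℤ.+ + b ℤ.* + 1
    numerators = trans (ℤ.pos-+ a b) (sym (cong₂ ℤ._+_ (ℤ.*-identityʳ (+ a)) (ℤ.*-identityʳ (+ b))))

  ι-homo-* : ∀ a b → ι (a ℕ.* b) ≡ ι a * ι b
  ι-homo-* a b = trans (/-cong {+ (a ℕ.* b)} {1} {+ a ℤ.* + b} {1} (ℤ.pos-* a b) refl)
                       (sym (cong₂ _*_ (ι≡mkℚ a) (ι≡mkℚ b)))

  ι-homo-^ : ∀ a j → ι (a ℕ.^ j) ≡ ι a ^ℚ j
  ι-homo-^ a zero    = refl
  ι-homo-^ a (suc j) = trans (ι-homo-* a (a ℕ.^ j)) (cong (ι a *_) (ι-homo-^ a j))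

  ι-mono-≤ : ∀ {a b} → a ℕ.≤ b → ι a ≤ ι b
  ι-mono-≤ {a} {b} a≤b = subst₂ _≤_ (sym (ι≡mkℚ a)) (sym (ι≡mkℚ b))
    (ℚ.*≤* (subst₂ ℤ._≤_ (sym (ℤ.*-identityʳ (+ a))) (sym (ℤ.*-identityʳ (+ b))) (ℤ.+≤+ a≤b)))

  ι-cancel-≤ : ∀ {a b} → ι a ≤ ι b → a ℕ.≤ b
  ι-cancel-≤ {a} {b} ιa≤ιb with subst₂ _≤_ (ι≡mkℚ a) (ι≡mkℚ b) ιa≤ιb
  ... | ℚ.*≤* a*1≤b*1 = ℤ.drop‿+≤+ (subst₂ ℤ._≤_ (ℤ.*-identityʳ (+ a)) (ℤ.*-identityʳ (+ b)) a*1≤b*1)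

  ι-nonNeg : ∀ a → 0ℚ ≤ ι a
  ι-nonNeg a = ι-mono-≤ {0} {a} ℕ.z≤n

  ι-pos : ∀ a → 1 ℕ.≤ a → 0ℚ < ι a
  ι-pos a 1≤a = <-≤-trans (ℚ.*<* (ℤ.+<+ (ℕ.s≤s ℕ.z≤n))) (ι-mono-≤ 1≤a)

  ι-homo-∸ : ∀ a b → b ℕ.≤ a → ι (a ℕ.∸ b) ≡ ι a - ι b
  ι-homo-∸ a b b≤a = begin
    ι (a ℕ.∸ b)                   ≡⟨ sym (x+y-y≡x (ι (a ℕ.∸ b)) (ι b)) ⟩
    ι (a ℕ.∸ b) + ι b - ι b        ≡⟨ cong (_- ι b) (sym (ι-homo-+ (a ℕ.∸ b) b)) ⟩
    ι (a ℕ.∸ b ℕ.+ b) - ι b        ≡⟨ cong (λ c → ι c - ι b) (ℕ.m∸n+n≡m b≤a) ⟩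
    ι a - ι b                      ∎
    where
    open ≡-Reasoning
    x+y-y≡x : ∀ x y → x + y - y ≡ x
    x+y-y≡x = solve 2 (λ x y → x :+ y :- y := x) refl

  *-monoˡ-≤-0≤ : ∀ {c a b} → 0ℚ ≤ c → a ≤ b → c * a ≤ c * b
  *-monoˡ-≤-0≤ {c} 0≤c = *-monoˡ-≤-nonNeg c {{ℚ.nonNegative 0≤c}}

  *-monoʳ-≤-0≤ : ∀ {c a b} → 0ℚ ≤ c → a ≤ b → a * c ≤ b * c
  *-monoʳ-≤-0≤ {c} 0≤c = *-monoʳ-≤-nonNeg c {{ℚ.nonNegative 0≤c}}

  *-monoˡ-<-0< : ∀ {c a b} → 0ℚ < c → a < b → c * a < c * b
  *-monoˡ-<-0< {c} 0<c = *-monoʳ-<-pos c {{ℚ.positive 0<c}}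

  0≤* : ∀ {a b} → 0ℚ ≤ a → 0ℚ ≤ b → 0ℚ ≤ a * b
  0≤* {a} 0≤a 0≤b = subst (_≤ a * _) (*-zeroʳ a) (*-monoˡ-≤-0≤ 0≤a 0≤b)

  *-mono-≤-0≤ : ∀ {a b c d} → 0ℚ ≤ a → 0ℚ ≤ c → a ≤ b → c ≤ d → a * c ≤ b * d
  *-mono-≤-0≤ 0≤a 0≤c a≤b c≤d = ≤-trans (*-monoʳ-≤-0≤ 0≤c a≤b) (*-monoˡ-≤-0≤ (≤-trans 0≤a a≤b) c≤d)

  ^ℚ-0≤ : ∀ {x} j → 0ℚ ≤ x → 0ℚ ≤ x ^ℚ j
  ^ℚ-0≤ zero    0≤x = ι-nonNeg 1
  ^ℚ-0≤ (suc j) 0≤x = 0≤* 0≤x (^ℚ-0≤ j 0≤x)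

  ^ℚ-mono-≤ : ∀ {x y} j → 0ℚ ≤ x → x ≤ y → x ^ℚ j ≤ y ^ℚ j
  ^ℚ-mono-≤ zero    0≤x x≤y = ≤-refl
  ^ℚ-mono-≤ (suc j) 0≤x x≤y = *-mono-≤-0≤ 0≤x (^ℚ-0≤ j 0≤x) x≤y (^ℚ-mono-≤ j 0≤x x≤y)

  ^ℚ-distribʳ-* : ∀ x y j → (x * y) ^ℚ j ≡ x ^ℚ j * y ^ℚ j
  ^ℚ-distribʳ-* x y zero    = refl
  ^ℚ-distribʳ-* x y (suc j) = trans (cong ((x * y) *_) (^ℚ-distribʳ-* x y j)) (interchange x y (x ^ℚ j) (y ^ℚ j))
    where
    interchange : ∀ a b c d → a * b * (c * d) ≡ a * c * (b * d)
    interchange = solve 4 (λ a b c d → (a :* b) :* (c :* d) := (a :* c) :* (b :* d)) refl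

  1^ℚ : ∀ j → 1ℚ ^ℚ j ≡ 1ℚ
  1^ℚ zero    = refl
  1^ℚ (suc j) = trans (*-identityˡ _) (1^ℚ j)

  ^ℚ-≤1 : ∀ {x} j → 0ℚ ≤ x → x ≤ 1ℚ → x ^ℚ j ≤ 1ℚ
  ^ℚ-≤1 {x} j 0≤x x≤1 = subst (x ^ℚ j ≤_) (1^ℚ j) (^ℚ-mono-≤ j 0≤x x≤1)

  ^ℚ-suc-≤ : ∀ {x} j → 0ℚ ≤ x → x ≤ 1ℚ → x ^ℚ suc j ≤ x
  ^ℚ-suc-≤ {x} j 0≤x x≤1 = subst (x * x ^ℚ j ≤_) (*-identityʳ x) (*-monoˡ-≤-0≤ 0≤x (^ℚ-≤1 j 0≤x x≤1))

  <^ℚ⇒< : ∀ {r y} j → 0ℚ ≤ r → r ≤ 1ℚ → 0ℚ ≤ y → r < y ^ℚ suc j → r < y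
  <^ℚ⇒< j 0≤r r≤1 0≤y r<y^ = ≰⇒> (λ y≤r → <-irrefl refl (<-≤-trans r<y^ (≤-trans (^ℚ-mono-≤ (suc j) 0≤y y≤r) (^ℚ-suc-≤ j 0≤r r≤1))))

  L<U : ∀ (x : ℝ) {p q} → ℝ.L x p → ℝ.U x q → p < q
  L<U x {p} {q} xp xq with <-cmp p q
  ... | tri< p<q _ _  = p<q
  ... | tri≈ _ refl _ = contradiction xq (disjoint x p xp)
  ... | tri> _ _ q<p  = contradiction xq (disjoint x q (L-lower x q<p xp))

  -- for r = (1 + a) / b in lowest terms, r * (K * b) = (1 + a) * K ≥ K
  archimedean : ∀ {r} → 0ℚ < r → ∀ K → ∃[ n₀ ] (∀ n → n₀ ℕ.< n → ι K ≤ r * ι n)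
  archimedean {mkℚ (+ zero)    _ _} 0<r K with () ← ℚ.positive 0<r
  archimedean {mkℚ ℤ.-[1+ _ ]  _ _} 0<r K with () ← ℚ.positive 0<r
  archimedean {r@(mkℚ (+ suc a) b-1 _)} 0<r K =
    K ℕ.* b , λ n Kb<n → ≤-trans K≤r*Kb (*-monoˡ-≤-0≤ (<⇒≤ 0<r) (ι-mono-≤ (ℕ.<⇒≤ Kb<n)))
    where
    b = suc b-1
    cross : + K ℤ.* + (b ℕ.* 1) ℤ.≤ (+ suc a ℤ.* + (K ℕ.* b)) ℤ.* + 1
    cross = subst₂ ℤ._≤_ (ℤ.pos-* K (b ℕ.* 1))
                         (trans (ℤ.pos-* (suc a ℕ.* (K ℕ.* b)) 1) (cong (ℤ._* + 1) (ℤ.pos-* (suc a) (K ℕ.* b))))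
                         (ℤ.+≤+ (subst₂ ℕ._≤_ (cong (K ℕ.*_) (sym (ℕ.*-identityʳ b))) (sym (ℕ.*-identityʳ _))
                                               (ℕ.m≤n*m (K ℕ.* b) (suc a))))
    K≤r*Kb : ι K ≤ r * ι (K ℕ.* b)
    K≤r*Kb = toℚᵘ-cancel-≤ (subst₂ ℚᵘ._≤_ (sym (cong ℚ.toℚᵘ (ι≡mkℚ K))) refl
      (ℚᵘ.≤-respʳ-≃ (ℚᵘ.≃-sym (ℚᵘ.≃-trans (toℚᵘ-homo-* r (ι (K ℕ.* b)))
                                          (ℚᵘ.≃-reflexive (cong (λ t → ℚ.toℚᵘ r ℚᵘ.* ℚ.toℚᵘ t) (ι≡mkℚ (K ℕ.* b))))))
                    (ℚᵘ.*≤* cross)))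

  ι-complement< : ∀ {e s C q p} → e ℕ.+ s ℕ.≤ C → (1ℚ - q) * ι C < ι e → q ≤ p → ι s < p * ι C
  ι-complement< {e} {s} {C} {q} {p} e+s≤C dense q≤p = begin-strict
    ι s                           ≡⟨ sym (x+y-y≡x (ι s) rest) ⟩
    ι s + rest - rest             <⟨ +-monoˡ-< (ℚ.- rest) s+rest<C ⟩
    ι C - rest                    ≡⟨ c-[1-q]c≡qc (ι C) q ⟩
    q * ι C                       ≤⟨ *-monoʳ-≤-0≤ (ι-nonNeg C) q≤p ⟩
    p * ι C                       ∎
    where
    open ≤-Reasoning
    rest = (1ℚ - q) * ι C
    x+y-y≡x : ∀ x y → x + y - y ≡ x
    x+y-y≡x = solve 2 (λ x y → x :+ y :- y := x) refl
    c-[1-q]c≡qc : ∀ c q → c - (1ℚ - q) * c ≡ q * c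
    c-[1-q]c≡qc = solve 2 (λ c q → c :- (con 1ℚ :- q) :* c := q :* c) refl
    s+rest<C : ι s + rest < ι C
    s+rest<C = begin-strict
      ι s + rest       <⟨ +-monoʳ-< (ι s) dense ⟩
      ι s + ι e        ≡⟨ +-comm (ι s) (ι e) ⟩
      ι e + ι s        ≡⟨ sym (ι-homo-+ e s) ⟩
      ι (e ℕ.+ s)      ≤⟨ ι-mono-≤ e+s≤C ⟩
      ι C              ∎

  ι+x≤ι⇒x≤ι∸ : ∀ {m o x} → 0ℚ ≤ x → ι m + x ≤ ι o → x ≤ ι (o ℕ.∸ m)
  ι+x≤ι⇒x≤ι∸ {m} {o} {x} 0≤x m+x≤o = begin
    x                 ≡⟨ sym (m+x-m≡x (ι m) x) ⟩
    ι m + x - ι m     ≤⟨ +-monoˡ-≤ (ℚ.- ι m) m+x≤o ⟩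
    ι o - ι m         ≡⟨ sym (ι-homo-∸ o m (ι-cancel-≤ (≤-trans m≤m+x m+x≤o))) ⟩
    ι (o ℕ.∸ m)       ∎
    where
    open ≤-Reasoning
    m+x-m≡x : ∀ m x → m + x - m ≡ x
    m+x-m≡x = solve 2 (λ m x → m :+ x :- m := x) refl
    m≤m+x : ι m ≤ ι m + x
    m≤m+x = subst (_≤ ι m + x) (+-identityʳ (ι m)) (+-monoʳ-≤ (ι m) 0≤x)

  module _ (M : ℕ) where

    private
      K : ℕ
      K = suc (suc M)

    ι-K!*s<[y*ιn]^K : ∀ {n s y} → 0ℚ ≤ y → ι s < y ^ℚ K * ι (n C K) → ι (K ! ℕ.* s) < (y * ι n) ^ℚ K
    ι-K!*s<[y*ιn]^K {n} {s} {y} 0≤y s<y^K*C = begin-strict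
      ι (K ! ℕ.* s)                 ≡⟨ ι-homo-* (K !) s ⟩
      ι (K !) * ι s                 <⟨ *-monoˡ-<-0< (ι-pos (K !) (ℕ.1≤n! K)) s<y^K*C ⟩
      ι (K !) * (y ^ℚ K * ι (n C K)) ≡⟨ swap (ι (K !)) (y ^ℚ K) (ι (n C K)) ⟩
      y ^ℚ K * (ι (K !) * ι (n C K)) ≡⟨ cong (y ^ℚ K *_) (sym (ι-homo-* (K !) (n C K))) ⟩
      y ^ℚ K * ι (K ! ℕ.* (n C K))  ≤⟨ *-monoˡ-≤-0≤ (^ℚ-0≤ K 0≤y) (ι-mono-≤ (k!*nCk≤n^k n K)) ⟩
      y ^ℚ K * ι (n ℕ.^ K)          ≡⟨ cong (y ^ℚ K *_) (ι-homo-^ n K) ⟩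
      y ^ℚ K * ι n ^ℚ K             ≡⟨ sym (^ℚ-distribʳ-* y (ι n) K) ⟩
      (y * ι n) ^ℚ K                ∎
      where
      open ≤-Reasoning
      swap : ∀ a b c → a * (b * c) ≡ b * (a * c)
      swap = solve 3 (λ a b c → a :* (b :* c) := b :* (a :* c)) refl

    [8x]²x^M≤ι[D²[D∸K]^M] : ∀ {D x} → 0ℚ ≤ x → ι K ≤ x → ι 8 * x ≤ ι D →
      ι 8 * x * (ι 8 * x) * x ^ℚ M ≤ ι (D ℕ.* D ℕ.* (D ℕ.∸ K) ℕ.^ M)
    [8x]²x^M≤ι[D²[D∸K]^M] {D} {x} 0≤x K≤x 8x≤D = subst (_ ≤_) (sym ι-D²[D∸K]^M)
      (*-mono-≤-0≤ (0≤* 0≤8x 0≤8x) (^ℚ-0≤ M 0≤x) (*-mono-≤-0≤ 0≤8x 0≤8x 8x≤D 8x≤D)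
                   (^ℚ-mono-≤ M 0≤x (ι+x≤ι⇒x≤ι∸ {K} {D} 0≤x K+x≤D)))
      where
      0≤8x = 0≤* (ι-nonNeg 8) 0≤x
      x+x≡2x : ∀ x → x + x ≡ (1ℚ + 1ℚ) * x
      x+x≡2x = solve 1 (λ x → x :+ x := (con 1ℚ :+ con 1ℚ) :* x) refl
      K+x≤D : ι K + x ≤ ι D
      K+x≤D = begin
        ι K + x   ≤⟨ +-monoˡ-≤ x K≤x ⟩
        x + x     ≡⟨ x+x≡2x x ⟩
        ι 2 * x   ≤⟨ *-monoʳ-≤-0≤ 0≤x (ι-mono-≤ {2} {8} (ℕ.s≤s (ℕ.s≤s ℕ.z≤n))) ⟩
        ι 8 * x   ≤⟨ 8x≤D ⟩
        ι D       ∎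
        where open ≤-Reasoning
      ι-D²[D∸K]^M : ι (D ℕ.* D ℕ.* (D ℕ.∸ K) ℕ.^ M) ≡ ι D * ι D * ι (D ℕ.∸ K) ^ℚ M
      ι-D²[D∸K]^M = trans (ι-homo-* (D ℕ.* D) _) (cong₂ _*_ (ι-homo-* D D) (ι-homo-^ (D ℕ.∸ K) M))

    component-≥ : ∀ n s e sp {q y} → s ℕ.≤ n → e ℕ.+ sp ℕ.≤ n C K → (1ℚ - q) * ι (n C K) < ι e →
      (n ℕ.∸ s) ℕ.* (n ℕ.∸ s) ℕ.* ((n ℕ.∸ s) ℕ.∸ K) ℕ.^ M ℕ.≤ 3 ℕ.* (K ! ℕ.* sp) →
      q < y ^ℚ K → 0ℚ ≤ y → ι K ≤ y * ι n → (1ℚ - ι 8 * y) * ι n ≤ ι s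
    component-≥ n s e sp {q} {y} s≤n e+sp≤C dense D-bound q<y^K 0≤y K≤x = ≮⇒≥ λ s<[1-8y]n → <-irrefl refl (begin-strict
      ι (D ℕ.* D ℕ.* (D ℕ.∸ K) ℕ.^ M)    ≤⟨ ι-mono-≤ D-bound ⟩
      ι (3 ℕ.* (K ! ℕ.* sp))             ≡⟨ ι-homo-* 3 (K ! ℕ.* sp) ⟩
      ι 3 * ι (K ! ℕ.* sp)               <⟨ *-monoˡ-<-0< (ι-pos 3 (ℕ.s≤s ℕ.z≤n))
                                              (ι-K!*s<[y*ιn]^K {n} {sp} 0≤y (ι-complement< {e} {sp} {n C K} e+sp≤C dense (<⇒≤ q<y^K))) ⟩
      ι 3 * x ^ℚ K                       ≤⟨ *-monoʳ-≤-0≤ (^ℚ-0≤ K 0≤x) (ι-mono-≤ {3} {64} (ℕ.m≤m+n 3 61)) ⟩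
      ι 64 * x ^ℚ K                      ≡⟨ cong (_* x ^ℚ K) (ι-homo-* 8 8) ⟩
      ι 8 * ι 8 * x ^ℚ K                 ≡⟨ regroup (ι 8) x (x ^ℚ M) ⟩
      ι 8 * x * (ι 8 * x) * x ^ℚ M        ≤⟨ [8x]²x^M≤ι[D²[D∸K]^M] {D} 0≤x K≤x (<⇒≤ (8x<D s<[1-8y]n)) ⟩
      ι (D ℕ.* D ℕ.* (D ℕ.∸ K) ℕ.^ M)    ∎)
      where
      open ≤-Reasoning
      D = n ℕ.∸ s
      x = y * ι n
      0≤x : 0ℚ ≤ x
      0≤x = 0≤* 0≤y (ι-nonNeg n)
      regroup : ∀ a x z → a * a * (x * (x * z)) ≡ a * x * (a * x) * z
      regroup = solve 3 (λ a x z → a :* a :* (x :* (x :* z)) := a :* x :* (a :* x) :* z) refl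
      n-[1-8y]n≡8x : ι n - (1ℚ - ι 8 * y) * ι n ≡ ι 8 * x
      n-[1-8y]n≡8x = solve 3 (λ n e y → n :- (con 1ℚ :- e :* y) :* n := e :* (y :* n)) refl (ι n) (ι 8) y
      8x<D : ι s < (1ℚ - ι 8 * y) * ι n → ι 8 * x < ι D
      8x<D s< = subst₂ _<_ n-[1-8y]n≡8x (sym (ι-homo-∸ n s s≤n)) (+-monoʳ-< (ι n) (neg-antimono-< s<))

open import Defs
open import Data.Nat using (ℕ; _≤_; _<_; _^_)
open import Data.Nat.Combinatorics using (_C_)
open import Data.Integer using (+_)
open import Data.Rational as ℚ using (ℚ; 0ℚ; 1ℚ; _/_)
open import Data.Fin using (Fin)
open import Data.Fin.Subset using (Subset; ∣_∣)
open import Data.Product using (Σ; ∃; ∃-syntax; _×_)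

open import Data.Nat using (zero; suc; s≤s; z≤n)
open import Data.Product using (_,_; proj₁; proj₂)
import Data.Rational.Properties as ℚ
open import Data.Fin.Subset.Properties using (∣p∣≤n)
open import Relation.Nullary.Decidable using (toWitness)
open Counting using (largestComponent-splitSets)
open Estimates using (archimedean; L<U; <^ℚ⇒<; ^ℚ-≤1; *-monoʳ-≤-0≤; ι-nonNeg; component-≥)

theorem4p1 : (k : ℕ) → 3 ≤ k → (ε : ℝ) → L ε 0ℚ → U ε ((+ 1 / 16) ^ℚ k)
    → ∃[ n₀ ] ((n : ℕ) → n₀ < n → (G : Hypergraph k n)
    → (∃[ q ] (L ε q × (1ℚ ℚ.- q) ℚ.* ℕ→ℚ (n C k) ℚ.< ℕ→ℚ (e G)))
    → (χ : Colouring G k)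
    → ∃[ c ] ∃[ S ] (IsComponent G χ c S
      × ((q : ℚ) → 0ℚ ℚ.< q → U ε (q ^ℚ k)
        → (1ℚ ℚ.- ℕ→ℚ 8 ℚ.* q) ℚ.* ℕ→ℚ n ℚ.≤ ℕ→ℚ ∣ S ∣)))
theorem4p1 k@(suc (suc (suc m))) (s≤s (s≤s (s≤s z≤n))) ε 0<ε ε<16⁻ᵏ = n₀ , λ
  { zero    ()
  ; (suc n) n₀<n G (q , q<ε , dense) χ →
      let c , S , S-component , splitSets , e+split≤C , gap-bound = largestComponent-splitSets G χ
      in c , S , S-component , λ y 0<y ε<y^k →
           component-≥ (suc m) (suc n) ∣ S ∣ (e G) splitSets (∣p∣≤n S) e+split≤C dense gap-bound
                       (L<U ε q<ε ε<y^k) (ℚ.<⇒≤ 0<y) (k≤y*n n₀<n 0<y ε<y^k) }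
  where
  r = proj₁ (L-rounded ε 0<ε)
  0<r = proj₁ (proj₂ (L-rounded ε 0<ε))
  r<ε = proj₂ (proj₂ (L-rounded ε 0<ε))
  n₀ = proj₁ (archimedean 0<r k)
  -- the only use of ε < 16⁻ᵏ
  r≤1 : r ℚ.≤ 1ℚ
  r≤1 = ℚ.≤-trans (ℚ.<⇒≤ (L<U ε r<ε ε<16⁻ᵏ))
                  (^ℚ-≤1 k (toWitness {a? = 0ℚ ℚ.≤? (+ 1 / 16)} _) (toWitness {a? = (+ 1 / 16) ℚ.≤? 1ℚ} _))
  k≤y*n : ∀ {n y} → n₀ < n → 0ℚ ℚ.< y → U ε (y ^ℚ k) → ℕ→ℚ k ℚ.≤ y ℚ.* ℕ→ℚ n
  k≤y*n {n} n₀<n 0<y ε<y^k = ℚ.≤-trans (proj₂ (archimedean 0<r k) n n₀<n)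
    (*-monoʳ-≤-0≤ (ι-nonNeg n) (ℚ.<⇒≤ (<^ℚ⇒< (suc (suc m)) (ℚ.<⇒≤ 0<r) r≤1 (ℚ.<⇒≤ 0<y) (L<U ε r<ε ε<y^k))))
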